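{- Let $\ell,m\geq 2$ be integers and let $T$ be a tree with at most $\ell$ leaves. Then there exist an integer $s\geq 0$ and vertex-disjoint bare paths $P_1,\dots,P_s$ in $T$, each of length $m$, such that $$|T-P_1-\ldots-P_s|\leq 6m\ell+\frac{2|T|}{m+1}.$$
   Context: A bare path $P$ in a tree $T$ is a path all of whose interior vertices have degree $2$ in $T$. For a bare path $P$ in $T$, $T-P$ denotes the graph obtained from $T$ by deleting the edges of $P$ and the interior vertices of $P$; $T-P_1-\ldots-P_s$ denotes the result of doing this successively for $P_1,\dots,P_s$. The length of a path is its number of edges, and $|H|$ denotes the number of vertices of a graph $H$. -}

module Defs where

open import Data.Bool using (Bool; true; false; T; if_then_else_; not)
open import Data.Nat using (ℕ; zero; suc; _+_; _*_; _≤_)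
import Data.Nat as ℕ
open import Data.Fin using (Fin)
import Data.Fin as Fin
open import Data.List using (List; []; _∷_; _++_; take; length; map; allFin; filter; concatMap; head; last)
open import Data.Nat.ListAction using (sum)
open import Data.List.Relation.Unary.Linked using (Linked)
open import Data.List.Relation.Unary.All using (All)
open import Data.List.Relation.Unary.AllPairs using (AllPairs)
open import Data.List.Relation.Unary.Unique.Propositional using (Unique)
open import Data.List.Relation.Binary.Disjoint.Propositional using (Disjoint)
import Data.List.Membership.DecPropositional as DecMem
open import Data.Product using (Σ; ∃; _×_; _,_)
open import Data.Maybe using (just)
open import Relation.Binary.PropositionalEquality using (_≡_)
open import Relation.Nullary using (¬_)
open import Relation.Nullary.Decidable using (⌊_⌋)

Graph : ℕ → Set
Graph n = Fin n → Fin n → Bool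

module _ {n : ℕ} (G : Graph n) where

  Adj : Fin n → Fin n → Set
  Adj u v = T (G u v)

  Symmetric : Set
  Symmetric = ∀ u v → G u v ≡ G v u

  Loopless : Set
  Loopless = ∀ v → G v v ≡ false

  Walk : Fin n → Fin n → List (Fin n) → Set
  Walk u v xs = Linked Adj xs × head xs ≡ just u × last xs ≡ just v

  Connected : Set
  Connected = ∀ u v → ∃ λ xs → Walk u v xs

  Cycle : List (Fin n) → Set
  Cycle xs = 3 ≤ length xs × Unique xs × Linked Adj (xs ++ take 1 xs)

  Acyclic : Set
  Acyclic = ∀ xs → ¬ Cycle xs

  IsTree : Set
  IsTree = Symmetric × Loopless × Connected × Acyclic

  deg : Fin n → ℕ
  deg v = sum (map (λ w → if G v w then 1 else 0) (allFin n))

  numLeaves : ℕ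
  numLeaves = sum (map (λ v → if ⌊ deg v ℕ.≟ 1 ⌋ then 1 else 0) (allFin n))

dropLast : ∀ {A : Set} → List A → List A
dropLast []           = []
dropLast (x ∷ [])     = []
dropLast (x ∷ y ∷ ys) = x ∷ dropLast (y ∷ ys)

interior : ∀ {A : Set} → List A → List A
interior []       = []
interior (x ∷ xs) = dropLast xs

module _ {n : ℕ} (G : Graph n) where

  IsPath : List (Fin n) → Set
  IsPath xs = Linked (Adj G) xs × Unique xs

  IsBarePath : List (Fin n) → Set
  IsBarePath xs = IsPath xs × All (λ v → deg G v ≡ 2) (interior xs)

  pathLength : List (Fin n) → ℕ
  pathLength xs = length xs Data.Nat.∸ 1

  -- |G - P₁ - … - Pₛ|: deleting a bare path removes its edges and its
  -- interior vertices; hence the remaining vertices are exactly those that are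
  -- not an interior vertex of any Pᵢ.
  remainingSize : List (List (Fin n)) → ℕ
  remainingSize Ps = length (filter (λ v → DecMem._∉?_ (Fin._≟_ {n}) v (concatMap interior Ps)) (allFin n))

-- Root the tree and call a vertex inner if it is not the root and has
-- degree 2. Cut every upward run of inner vertices, from its top down, into
-- blocks of m + 1 consecutive vertices: each complete block, with the parent
-- edges between its vertices, is a bare path of length m, and these paths
-- are vertex-disjoint, so their number C satisfies (m + 1) C ≤ n. A vertex
-- that survives the deletion is an endpoint of a chosen path, or lies at most
-- m steps above a non-inner vertex (the incomplete block at the bottom of a
-- run, or that vertex itself). By the handshake bound ∑ deg ≤ 2n there are
-- N ≤ 2ℓ + 4 non-inner vertices, so at most (m + 1) N + 2C vertices remain,
-- and (m + 1)(2ℓ + 4) ≤ 6mℓ for m, ℓ ≥ 2 gives the bound.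

module Submission where

open import Defs

open import Data.Bool using (Bool; true; false; if_then_else_; T)
open import Data.Empty using (⊥; ⊥-elim)
open import Data.Fin using (Fin; zero; suc; _≟_)
open import Data.Fin.Properties using (injective⇒≤; any?)
open import Data.List
  using (List; []; _∷_; _++_; _∷ʳ_; length; map; filter; allFin; tabulate; lookup; concatMap; applyUpTo; last)
open import Data.List.Properties using (length-++; map-tabulate; applyUpTo-∷ʳ; length-applyUpTo; length-tabulate)
open import Data.List.Membership.Propositional using (_∈_; _∉_)
open import Data.List.Membership.Propositional.Properties
  using ( ∈-lookup; ∈-applyUpTo⁺; ∈-applyUpTo⁻; ∈-++⁺ˡ; ∈-++⁺ʳ; ∈-concat⁺′; ∈-map⁺
        ; ∈-filter⁺; ∈-filter⁻; ∈-allFin)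
open import Data.List.Relation.Binary.Disjoint.Propositional using (Disjoint)
open import Data.List.Relation.Binary.Subset.Propositional using (_⊆_)
open import Data.List.Relation.Unary.All as All using (All; []; _∷_)
import Data.List.Relation.Unary.All.Properties as Allₚ
open import Data.List.Relation.Unary.AllPairs using (AllPairs; []; _∷_)
import Data.List.Relation.Unary.AllPairs.Properties as AllPairsₚ
open import Data.List.Relation.Unary.Any using (index; here; there)
open import Data.List.Relation.Unary.Any.Properties using (lookup-index)
open import Data.List.Relation.Unary.Linked using (Linked; [-]; _∷_)
import Data.List.Relation.Unary.Linked.Properties as Linkedₚ
open import Data.List.Relation.Unary.Unique.Propositional using (Unique)
open import Data.List.Relation.Unary.Unique.Propositional.Properties using (filter⁺; allFin⁺; concat⁺)
open import Data.Maybe using (just)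
import Data.Nat as ℕ
open import Data.Nat
  using (ℕ; zero; suc; _+_; _*_; _∸_; _≤_; _<_; z≤n; s≤s; s≤s⁻¹; z<s; _≤′_; ≤′-refl; ≤′-step)
open import Data.Nat.DivMod using (_%_; m%n<n; m<n⇒m%n≡m; n%n≡0)
import Data.Nat.ListAction as List
open import Data.Nat.Properties hiding (_≟_)
open import Data.Nat.Solver using (module +-*-Solver)
open import Algebra.Properties.Semiring.Sum +-*-semiring
  using (sum-syntax; sum-cong-≗; ∑-distrib-+; ∑-comm; *-distribˡ-sum)
open import Data.Product using (∃; ∃₂; _×_; _,_; proj₁; proj₂)
open import Data.Sum using (_⊎_; inj₁; inj₂)
open import Data.Unit using (tt)
open import Function using (_∘_; id)
open import Level using (0ℓ)
open import Relation.Binary using (Rel)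
open import Relation.Binary.Definitions using (tri<; tri≈; tri>)
open import Relation.Binary.PropositionalEquality
open import Relation.Nullary using (Dec; yes; no; does; ¬_; ¬?; T?; _×-dec_; _⊎-dec_)
open import Relation.Nullary.Decidable using (⌊_⌋; decidable-stable)
open import Relation.Unary using (Pred; Decidable)

-- Written as in Defs, so that deg and numLeaves unfold to sums of ⟦_⟧.
⟦_⟧ : Bool → ℕ
⟦ b ⟧ = if b then 1 else 0

module _ {a p} {A : Set a} {P : Pred A p} (P? : Decidable P) where

  length-filter≡sum : ∀ xs → length (filter P? xs) ≡ List.sum (map (λ x → ⟦ does (P? x) ⟧) xs)
  length-filter≡sum []       = refl
  length-filter≡sum (x ∷ xs) with does (P? x)
  ... | true  = cong suc (length-filter≡sum xs)
  ... | false = length-filter≡sum xs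

module _ {a} {A : Set a} where

  lookup-injective : ∀ {xs : List A} → Unique xs → ∀ {i j} → lookup xs i ≡ lookup xs j → i ≡ j
  lookup-injective (_  ∷ _) {zero}  {zero}  _  = refl
  lookup-injective (x≢ ∷ _) {zero}  {suc j} eq = ⊥-elim (All.lookup x≢ (∈-lookup j) eq)
  lookup-injective (x≢ ∷ _) {suc i} {zero}  eq = ⊥-elim (All.lookup x≢ (∈-lookup i) (sym eq))
  lookup-injective (_  ∷ u) {suc i} {suc j} eq = cong suc (lookup-injective u eq)

  Unique-⊆⇒length≤ : ∀ {xs ys : List A} → Unique xs → xs ⊆ ys → length xs ≤ length ys
  Unique-⊆⇒length≤ {xs} {ys} xs! xs⊆ys = injective⇒≤ position-injective
    where
    position : Fin (length xs) → Fin (length ys)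
    position i = index (xs⊆ys (∈-lookup {xs = xs} i))
    position-injective : ∀ {i j} → position i ≡ position j → i ≡ j
    position-injective {i} {j} eq = lookup-injective xs! (begin
      lookup xs i            ≡⟨ lookup-index (xs⊆ys (∈-lookup i)) ⟩
      lookup ys (position i) ≡⟨ cong (lookup ys) eq ⟩
      lookup ys (position j) ≡⟨ lookup-index (xs⊆ys (∈-lookup j)) ⟨
      lookup xs j            ∎)
      where open ≡-Reasoning

  length-concatMap : ∀ {b} {B : Set b} (f : A → List B) {k} → (∀ x → length (f x) ≡ k) →
                     ∀ xs → length (concatMap f xs) ≡ length xs * k
  length-concatMap f f≡k []       = refl
  length-concatMap f f≡k (x ∷ xs) = begin
    length (f x ++ concatMap f xs)          ≡⟨ length-++ (f x) ⟩
    length (f x) + length (concatMap f xs)  ≡⟨ cong₂ _+_ (f≡k x) (length-concatMap f f≡k xs) ⟩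
    _ + length xs * _                       ∎
    where open ≡-Reasoning

module _ {A : Set} where

  dropLast-∷ʳ : ∀ (xs : List A) x → dropLast (xs ∷ʳ x) ≡ xs
  dropLast-∷ʳ []           x = refl
  dropLast-∷ʳ (y ∷ [])     x = refl
  dropLast-∷ʳ (y ∷ z ∷ zs) x = cong (y ∷_) (dropLast-∷ʳ (z ∷ zs) x)

  interior-applyUpTo : ∀ (f : ℕ → A) m → interior (applyUpTo f (suc (suc m))) ≡ applyUpTo (f ∘ suc) m
  interior-applyUpTo f m = trans (cong dropLast (sym (applyUpTo-∷ʳ (f ∘ suc) m))) (dropLast-∷ʳ _ _)

  ∈-interior-applyUpTo : ∀ (f : ℕ → A) {i m} → 0 < i → i < m → f i ∈ interior (applyUpTo f (suc m))
  ∈-interior-applyUpTo f {suc i} {suc m} _ (s≤s i<m) =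
    subst (f (suc i) ∈_) (sym (interior-applyUpTo f m)) (∈-applyUpTo⁺ (f ∘ suc) i<m)

  All-dropLast : ∀ {p} {P : Pred A p} {xs} → All P xs → All P (dropLast xs)
  All-dropLast {xs = []}        []         = []
  All-dropLast {xs = _ ∷ []}    _          = []
  All-dropLast {xs = _ ∷ _ ∷ _} (px ∷ pxs) = px ∷ All-dropLast pxs

  All-interior : ∀ {p} {P : Pred A p} {xs} → All P xs → All P (interior xs)
  All-interior []        = []
  All-interior (_ ∷ pxs) = All-dropLast pxs

module _ {a p r s} {A : Set a} {P : Pred A p} {R : Rel A r} {S : Rel A s} where

  AllPairs-map-All : (∀ {x y} → P x → P y → R x y → S x y) →
                     ∀ {xs} → All P xs → AllPairs R xs → AllPairs S xs
  AllPairs-map-All f []         []           = []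
  AllPairs-map-All f (px ∷ pxs) (Rx ∷ Rxs) =
    All.zipWith (λ (py , Rxy) → f px py Rxy) (pxs , Rx) ∷ AllPairs-map-All f pxs Rxs

∑-mono-≤ : ∀ {n} {f g : Fin n → ℕ} → (∀ i → f i ≤ g i) → ∑[ i < n ] f i ≤ ∑[ i < n ] g i
∑-mono-≤ {zero}  f≤g = z≤n
∑-mono-≤ {suc n} f≤g = +-mono-≤ (f≤g zero) (∑-mono-≤ (f≤g ∘ suc))

∑-const : ∀ n c → ∑[ i < n ] c ≡ n * c
∑-const zero    c = refl
∑-const (suc n) c = cong (c +_) (∑-const n c)

sum-map-allFin : ∀ n (f : Fin n → ℕ) → List.sum (map f (allFin n)) ≡ ∑[ i < n ] f i
sum-map-allFin n f = trans (cong List.sum (map-tabulate id f)) (sum-tabulate n f)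
  where
  sum-tabulate : ∀ n (f : Fin n → ℕ) → List.sum (tabulate f) ≡ ∑[ i < n ] f i
  sum-tabulate zero    f = refl
  sum-tabulate (suc n) f = cong (f zero +_) (sum-tabulate n (f ∘ suc))

δ : ∀ {n} → Fin n → Fin n → ℕ
δ x y = ⟦ does (x ≟ y) ⟧

δ-≡ : ∀ {n} {x y : Fin n} → x ≡ y → δ x y ≡ 1
δ-≡ {x = x} refl with x ≟ x
... | yes _   = refl
... | no x≢x = ⊥-elim (x≢x refl)

∑-δ : ∀ {n} (v : Fin n) → ∑[ x < n ] δ x v ≡ 1
∑-δ {suc n} zero    = cong suc (trans (∑-const n 0) (*-zeroʳ n))
∑-δ {suc n} (suc v) = ∑-δ v

module _ {p} {P : Pred ℕ p} (P? : Decidable P) (P-mono : ∀ {i j} → i ≤ j → P i → P j) where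

  least : ∀ {b} → P b → ∃ λ i → P i × (∀ {j} → P j → i ≤ j)
  least {zero}  Pb = 0 , Pb , λ _ → z≤n
  least {suc b} Pb with P? b
  ... | yes Pb′ = least Pb′
  ... | no ¬Pb′ = suc b , Pb , λ Pj → ≰⇒> (λ j≤b → ¬Pb′ (P-mono j≤b Pj))

module BreadthFirst {n} (G : Graph n) (connected : Connected G) (root : Fin n) where

  RootWithin : ℕ → Pred (Fin n) 0ℓ
  RootWithin zero    v = v ≡ root
  RootWithin (suc i) v = RootWithin i v ⊎ ∃ λ w → Adj G v w × RootWithin i w

  rootWithin? : ∀ i → Decidable (RootWithin i)
  rootWithin? zero    v = v ≟ root
  rootWithin? (suc i) v = rootWithin? i v ⊎-dec any? (λ w → T? (G v w) ×-dec rootWithin? i w)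

  RootWithin-mono : ∀ {v i j} → i ≤ j → RootWithin i v → RootWithin j v
  RootWithin-mono i≤j = mono (≤⇒≤′ i≤j)
    where
    mono : ∀ {v i j} → i ≤′ j → RootWithin i v → RootWithin j v
    mono ≤′-refl        = id
    mono (≤′-step i≤′j) = inj₁ ∘ mono i≤′j

  walk⇒RootWithin : ∀ {v} xs → Linked (Adj G) (v ∷ xs) → last (v ∷ xs) ≡ just root →
                    RootWithin (length xs) v
  walk⇒RootWithin []       _           refl = refl
  walk⇒RootWithin (w ∷ xs) (vw ∷ walk) eq   = inj₂ (w , vw , walk⇒RootWithin xs walk eq)

  private
    shortest : ∀ v → ∃ λ i → RootWithin i v × (∀ {j} → RootWithin j v → i ≤ j)
    shortest v with connected v root
    ... | (_ ∷ xs) , walk , refl , ends =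
      least (λ i → rootWithin? i v) RootWithin-mono (walk⇒RootWithin xs walk ends)

  depth : Fin n → ℕ
  depth v = proj₁ (shortest v)

  depth-RootWithin : ∀ v → RootWithin (depth v) v
  depth-RootWithin v = proj₁ (proj₂ (shortest v))

  depth-minimal : ∀ {i v} → RootWithin i v → depth v ≤ i
  depth-minimal {v = v} = proj₂ (proj₂ (shortest v))

  depth-root : depth root ≡ 0
  depth-root = n≤0⇒n≡0 (depth-minimal refl)

  depth≡0⇒root : ∀ {v} → depth v ≡ 0 → v ≡ root
  depth≡0⇒root {v} eq = subst (λ i → RootWithin i v) eq (depth-RootWithin v)

  depth≡suc⇒≢root : ∀ {v t} → depth v ≡ suc t → v ≢ root
  depth≡suc⇒≢root eq refl = 0≢1+n (trans (sym depth-root) eq)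

  depth-adj : ∀ {v w} → Adj G v w → depth v ≤ suc (depth w)
  depth-adj {w = w} vw = depth-minimal (inj₂ (w , vw , depth-RootWithin w))

  record Parent (v : Fin n) : Set where
    field
      vertex    : Fin n
      adjacent  : Adj G v vertex
      depth-suc : depth v ≡ suc (depth vertex)

  parent? : ∀ v → v ≡ root ⊎ Parent v
  parent? v with depth v in eq | depth-RootWithin v
  ... | zero  | v≡root            = inj₁ v≡root
  ... | suc i | inj₁ near         = ⊥-elim (1+n≰n (subst (_≤ i) eq (depth-minimal near)))
  ... | suc i | inj₂ (w , vw , near) = inj₂ (record
    { vertex    = w
    ; adjacent  = vw
    ; depth-suc = trans eq (cong suc (≤-antisym i≤dw (depth-minimal near)))
    })
    where
    i≤dw : i ≤ depth w
    i≤dw = s≤s⁻¹ (subst (_≤ suc (depth w)) eq (depth-adj vw))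

  parent : Fin n → Fin n
  parent v with parent? v
  ... | inj₁ _ = v
  ... | inj₂ P = Parent.vertex P

  parent-adj : ∀ {v} → v ≢ root → Adj G v (parent v)
  parent-adj {v} v≢root with parent? v
  ... | inj₁ v≡root = ⊥-elim (v≢root v≡root)
  ... | inj₂ P      = Parent.adjacent P

  depth-parent : ∀ {v} → v ≢ root → depth v ≡ suc (depth (parent v))
  depth-parent {v} v≢root with parent? v
  ... | inj₁ v≡root = ⊥-elim (v≢root v≡root)
  ... | inj₂ P      = Parent.depth-suc P

  depth-parent-pred : ∀ {v t} → depth v ≡ suc t → depth (parent v) ≡ t
  depth-parent-pred dv = suc-injective (trans (sym (depth-parent (depth≡suc⇒≢root dv))) dv)

module Degree {n} (G : Graph n) where

  neighbours : Fin n → List (Fin n)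
  neighbours v = filter (T? ∘ G v) (allFin n)

  neighbours-unique : ∀ v → Unique (neighbours v)
  neighbours-unique v = filter⁺ (T? ∘ G v) {allFin n} (allFin⁺ n)

  deg≡length-neighbours : ∀ v → deg G v ≡ length (neighbours v)
  deg≡length-neighbours v = sym (length-filter≡sum (T? ∘ G v) (allFin n))

  deg≡∑ : ∀ v → deg G v ≡ ∑[ w < n ] ⟦ G v w ⟧
  deg≡∑ v = sum-map-allFin n (⟦_⟧ ∘ G v)

  Unique-adj⇒length≤deg : ∀ {v xs} → Unique xs → All (Adj G v) xs → length xs ≤ deg G v
  Unique-adj⇒length≤deg {v} xs! adj = subst (_ ≤_) (sym (deg≡length-neighbours v))
    (Unique-⊆⇒length≤ xs! (λ x∈xs → ∈-filter⁺ (T? ∘ G v) (∈-allFin _) (All.lookup adj x∈xs)))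

  adj⇒deg≥1 : ∀ {v w} → Adj G v w → 1 ≤ deg G v
  adj⇒deg≥1 vw = Unique-adj⇒length≤deg ([] ∷ []) (vw ∷ [])

  adj⇒deg≥3 : ∀ {v a b c} → a ≢ b → a ≢ c → b ≢ c →
              Adj G v a → Adj G v b → Adj G v c → 3 ≤ deg G v
  adj⇒deg≥3 a≢b a≢c b≢c va vb vc =
    Unique-adj⇒length≤deg ((a≢b ∷ a≢c ∷ []) ∷ (b≢c ∷ []) ∷ [] ∷ []) (va ∷ vb ∷ vc ∷ [])

  deg≤1 : ∀ {v x} → (∀ {w} → Adj G v w → w ≡ x) → deg G v ≤ 1
  deg≤1 {v} {x} only-x = subst (_≤ 1) (sym (deg≡length-neighbours v))
    (Unique-⊆⇒length≤ {ys = x ∷ []} (neighbours-unique v)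
      (λ w∈ → here (only-x (proj₂ (∈-filter⁻ (T? ∘ G v) {xs = allFin n} w∈)))))

module RootedTree {n} (G : Graph n) (symmetric : Symmetric G) (loopless : Loopless G)
                  (connected : Connected G) (acyclic : Acyclic G) (root : Fin n) where

  open BreadthFirst G connected root public
  open Degree G

  Adj-sym : ∀ {u v} → Adj G u v → Adj G v u
  Adj-sym {u} {v} = subst T (symmetric u v)

  Adj⇒≢ : ∀ {u v} → Adj G u v → u ≢ v
  Adj⇒≢ {u} uv refl = subst T (loopless u) uv

  depth<⇒≢ : ∀ {u v} → depth u < depth v → u ≢ v
  depth<⇒≢ du<dv refl = <-irrefl refl du<dv

  depth≡0-unique : ∀ {u v} → depth u ≡ 0 → depth v ≡ 0 → u ≡ v
  depth≡0-unique du dv = trans (depth≡0⇒root du) (sym (depth≡0⇒root dv))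

  -- For a ≢ b of depth t, route t a b ys climbs from a (exclusive) to the
  -- last common ancestor of a and b, descends to b, and continues with ys.
  route : ℕ → Fin n → Fin n → List (Fin n) → List (Fin n)
  route zero    a b ys = b ∷ ys
  route (suc t) a b ys with parent a ≟ parent b
  ... | yes _ = parent a ∷ b ∷ ys
  ... | no  _ = parent a ∷ route t (parent a) (parent b) (b ∷ ys)

  route-++ : ∀ t a b ys zs → route t a b ys ++ zs ≡ route t a b (ys ++ zs)
  route-++ zero    a b ys zs = refl
  route-++ (suc t) a b ys zs with parent a ≟ parent b
  ... | yes _ = refl
  ... | no  _ = cong (parent a ∷_) (route-++ t (parent a) (parent b) (b ∷ ys) zs)

  route-nonempty : ∀ t a b ys → 1 ≤ length (route t a b ys)
  route-nonempty zero    a b ys = s≤s z≤n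
  route-nonempty (suc t) a b ys with parent a ≟ parent b
  ... | yes _ = s≤s z≤n
  ... | no  _ = s≤s z≤n

  route-linked : ∀ t {a b ys} → depth a ≡ t → depth b ≡ t → a ≢ b →
                 Linked (Adj G) (b ∷ ys) → Linked (Adj G) (a ∷ route t a b ys)
  route-linked zero    da db a≢b _ = ⊥-elim (a≢b (depth≡0-unique da db))
  route-linked (suc t) {a} {b} da db a≢b b-ys with parent a ≟ parent b
  ... | yes pa≡pb = a↑ ∷ subst (λ x → Adj G x b) (sym pa≡pb) b↑ ∷ b-ys
    where
    a↑ = parent-adj (depth≡suc⇒≢root da)
    b↑ = Adj-sym (parent-adj (depth≡suc⇒≢root db))
  ... | no pa≢pb = parent-adj (depth≡suc⇒≢root da) ∷
    route-linked t (depth-parent-pred da) (depth-parent-pred db) pa≢pb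
      (Adj-sym (parent-adj (depth≡suc⇒≢root db)) ∷ b-ys)

  route-∈ : ∀ t {a b ys x} → depth a ≡ t → depth b ≡ t → x ∈ route t a b ys →
            depth x < t ⊎ x ≡ b ⊎ x ∈ ys
  route-∈ zero    da db (here x≡b)  = inj₂ (inj₁ x≡b)
  route-∈ zero    da db (there x∈)  = inj₂ (inj₂ x∈)
  route-∈ (suc t) {a} {b} da db x∈ with parent a ≟ parent b
  route-∈ (suc t) da db (here refl)         | yes _ = inj₁ (≤-reflexive (cong suc (depth-parent-pred da)))
  route-∈ (suc t) da db (there (here x≡b))  | yes _ = inj₂ (inj₁ x≡b)
  route-∈ (suc t) da db (there (there x∈))  | yes _ = inj₂ (inj₂ x∈)
  route-∈ (suc t) da db (here refl)         | no _  = inj₁ (≤-reflexive (cong suc (depth-parent-pred da)))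
  route-∈ (suc t) da db (there x∈)          | no _
    with route-∈ t (depth-parent-pred da) (depth-parent-pred db) x∈
  ... | inj₁ dx<t           = inj₁ (m<n⇒m<1+n dx<t)
  ... | inj₂ (inj₁ refl)    = inj₁ (≤-reflexive (cong suc (depth-parent-pred db)))
  ... | inj₂ (inj₂ (here x≡b)) = inj₂ (inj₁ x≡b)
  ... | inj₂ (inj₂ (there x∈ys)) = inj₂ (inj₂ x∈ys)

  route-unique : ∀ t {a b ys} → depth a ≡ t → depth b ≡ t → a ≢ b →
                 Unique ys → All (λ y → t < depth y) ys → Unique (a ∷ route t a b ys)
  route-unique zero    da db a≢b _ _ = ⊥-elim (a≢b (depth≡0-unique da db))
  route-unique (suc t) {a} {b} {ys} da db a≢b ys! deep = All.tabulate a∉route ∷ rest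
    where
    above-ys : ∀ {v} → depth v ≤ suc t → All (v ≢_) ys
    above-ys dv≤ = All.map (λ t<dy → depth<⇒≢ (≤-<-trans dv≤ t<dy)) deep
    a∉route : ∀ {x} → x ∈ route (suc t) a b ys → a ≢ x
    a∉route x∈ with route-∈ (suc t) da db x∈
    ... | inj₁ dx<t        = depth<⇒≢ (subst (_ <_) (sym da) dx<t) ∘ sym
    ... | inj₂ (inj₁ refl) = a≢b
    ... | inj₂ (inj₂ x∈ys) = All.lookup (above-ys (≤-reflexive da)) x∈ys
    rest : Unique (route (suc t) a b ys)
    rest with parent a ≟ parent b
    ... | yes _ = (depth<⇒≢ pa<b ∷ above-ys (<⇒≤ pa<b′)) ∷ above-ys (≤-reflexive db) ∷ ys!
      where
      pa<b′ : depth (parent a) < suc t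
      pa<b′ = ≤-reflexive (cong suc (depth-parent-pred da))
      pa<b : depth (parent a) < depth b
      pa<b = subst (_ <_) (sym db) pa<b′
    ... | no pa≢pb = route-unique t (depth-parent-pred da) (depth-parent-pred db) pa≢pb
      (above-ys (≤-reflexive db) ∷ ys!) (≤-reflexive (sym db) ∷ All.map <⇒≤ deep)

  no-detour : ∀ t {a b ys} → depth a ≡ t → depth b ≡ t → a ≢ b →
              Linked (Adj G) (b ∷ ys ++ a ∷ []) → Unique ys → All (λ y → t < depth y) ys → ⊥
  no-detour zero    da db a≢b _ _ _ = a≢b (depth≡0-unique da db)
  no-detour (suc t) {a} {b} {ys} da db a≢b b-ys-a ys! deep =
    acyclic (a ∷ route (suc t) a b ys) (long , route-unique (suc t) da db a≢b ys! deep , closed)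
    where
    long : 3 ≤ length (a ∷ route (suc t) a b ys)
    long with parent a ≟ parent b
    ... | yes _ = s≤s (s≤s (s≤s z≤n))
    ... | no  _ = s≤s (s≤s (route-nonempty t _ _ _))
    closed : Linked (Adj G) (a ∷ route (suc t) a b ys ++ a ∷ [])
    closed = subst (Linked (Adj G) ∘ (a ∷_)) (sym (route-++ (suc t) a b ys (a ∷ [])))
                   (route-linked (suc t) da db a≢b b-ys-a)

  adj-deeper⇒parent : ∀ {v w} → Adj G v w → depth v ≡ suc (depth w) → w ≡ parent v
  adj-deeper⇒parent {v} {w} vw dv with w ≟ parent v
  ... | yes w≡pv = w≡pv
  ... | no  w≢pv = ⊥-elim (no-detour (depth w) (depth-parent-pred dv) refl (w≢pv ∘ sym)
    (Adj-sym vw ∷ parent-adj (depth≡suc⇒≢root dv) ∷ [-]) ([] ∷ []) (≤-reflexive (sym dv) ∷ []))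

  adj⇒parent : ∀ {u w} → Adj G u w → w ≡ parent u ⊎ u ≡ parent w
  adj⇒parent {u} {w} uw with <-cmp (depth u) (depth w)
  ... | tri≈ _ du≡dw _ = ⊥-elim (no-detour _ refl (sym du≡dw) (Adj⇒≢ uw) (Adj-sym uw ∷ [-]) [] [])
  ... | tri< du<dw _ _ = inj₂ (adj-deeper⇒parent (Adj-sym uw) (≤-antisym (depth-adj (Adj-sym uw)) du<dw))
  ... | tri> _ _ dw<du = inj₁ (adj-deeper⇒parent uw (≤-antisym (depth-adj uw) dw<du))

  adj-indicator≤ : ∀ v w → ⟦ G v w ⟧ ≤ δ w (parent v) + δ v (parent w)
  adj-indicator≤ v w with G v w in vw
  ... | false = z≤n
  ... | true with adj⇒parent {v} {w} (subst T (sym vw) tt)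
  ...   | inj₁ w≡pv = ≤-trans (≤-reflexive (sym (δ-≡ w≡pv))) (m≤m+n _ _)
  ...   | inj₂ v≡pw = ≤-trans (≤-reflexive (sym (δ-≡ v≡pw))) (m≤n+m _ _)

  ∑deg≤2n : ∑[ v < n ] deg G v ≤ 2 * n
  ∑deg≤2n = begin
    ∑[ v < n ] deg G v
      ≡⟨ sum-cong-≗ deg≡∑ ⟩
    ∑[ v < n ] ∑[ w < n ] ⟦ G v w ⟧
      ≤⟨ ∑-mono-≤ (λ v → ∑-mono-≤ (adj-indicator≤ v)) ⟩
    ∑[ v < n ] ∑[ w < n ] (δ w (parent v) + δ v (parent w))
      ≡⟨ sum-cong-≗ (λ v → ∑-distrib-+ (λ w → δ w (parent v)) (λ w → δ v (parent w))) ⟩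
    ∑[ v < n ] (∑[ w < n ] δ w (parent v) + ∑[ w < n ] δ v (parent w))
      ≡⟨ ∑-distrib-+ (λ v → ∑[ w < n ] δ w (parent v)) (λ v → ∑[ w < n ] δ v (parent w)) ⟩
    ∑[ v < n ] ∑[ w < n ] δ w (parent v) + ∑[ v < n ] ∑[ w < n ] δ v (parent w)
      ≡⟨ cong (∑[ v < n ] ∑[ w < n ] δ w (parent v) +_) (∑-comm (λ v w → δ v (parent w))) ⟩
    ∑[ v < n ] ∑[ w < n ] δ w (parent v) + ∑[ w < n ] ∑[ v < n ] δ v (parent w)
      ≡⟨ cong₂ _+_ (sum-cong-≗ (∑-δ ∘ parent)) (sum-cong-≗ (∑-δ ∘ parent)) ⟩
    ∑[ v < n ] 1 + ∑[ w < n ] 1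
      ≡⟨ cong₂ _+_ (∑-const n 1) (trans (∑-const n 1) (sym (+-identityʳ (n * 1)))) ⟩
    n * 1 + (n * 1 + 0)
      ≡⟨ cong (λ k → k + (k + 0)) (*-identityʳ n) ⟩
    2 * n ∎
    where open ≤-Reasoning

  Inner : Pred (Fin n) 0ℓ
  Inner v = v ≢ root × deg G v ≡ 2

  inner? : Decidable Inner
  inner? v = ¬? (v ≟ root) ×-dec (deg G v ℕ.≟ 2)

  inner-child-unique : ∀ {c a b} → Inner c → a ≢ root → b ≢ root →
                       parent a ≡ c → parent b ≡ c → a ≡ b
  inner-child-unique {c} {a} {b} (c≢root , dc≡2) a≢root b≢root pa≡c pb≡c with a ≟ b
  ... | yes a≡b = a≡b
  ... | no  a≢b = ⊥-elim (<⇒≱ (adj⇒deg≥3 a≢b (child≢pc a≢root pa≡c) (child≢pc b≢root pb≡c)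
                                  (ca a≢root pa≡c) (ca b≢root pb≡c) (parent-adj c≢root))
                               (≤-reflexive dc≡2))
    where
    ca : ∀ {x} → x ≢ root → parent x ≡ c → Adj G c x
    ca x≢root px≡c = Adj-sym (subst (Adj G _) px≡c (parent-adj x≢root))
    child≢pc : ∀ {x} → x ≢ root → parent x ≡ c → x ≢ parent c
    child≢pc {x} x≢root px≡c = depth<⇒≢ (begin-strict
      depth (parent c)        <⟨ ≤-reflexive (sym (depth-parent c≢root)) ⟩
      depth c                 ≡⟨ cong depth px≡c ⟨
      depth (parent x)        <⟨ ≤-reflexive (sym (depth-parent x≢root)) ⟩
      depth x                 ∎) ∘ sym
      where open ≤-Reasoning

  inner-child : ∀ {c} → Inner c → ∃ λ y → parent y ≡ c
  inner-child {c} (c≢root , dc≡2) with any? (λ w → T? (G c w) ×-dec ¬? (w ≟ parent c))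
  ... | yes (w , cw , w≢pc) with adj⇒parent cw
  ...   | inj₁ w≡pc = ⊥-elim (w≢pc w≡pc)
  ...   | inj₂ c≡pw = w , sym c≡pw
  inner-child {c} (c≢root , dc≡2) | no ¬other =
    ⊥-elim (<⇒≱ (≤-reflexive (sym dc≡2)) (deg≤1 only-parent))
    where
    only-parent : ∀ {w} → Adj G c w → w ≡ parent c
    only-parent {w} cw = decidable-stable (w ≟ parent c) (λ w≢pc → ¬other (w , cw , w≢pc))

  outer-weight : ∀ v →
    2 + ⟦ does (¬? (inner? v)) ⟧ ≤ deg G v + 2 * ⟦ ⌊ deg G v ℕ.≟ 1 ⌋ ⟧ + 4 * δ v root
  outer-weight v = weight (inner? v) (v ≟ root)
    where
    weight-≢2 : ∀ d → 1 ≤ d → d ≢ 2 → 3 ≤ d + 2 * ⟦ ⌊ d ℕ.≟ 1 ⌋ ⟧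
    weight-≢2 1                 _ _   = ≤-refl
    weight-≢2 2                 _ d≢2 = ⊥-elim (d≢2 refl)
    weight-≢2 (suc (suc (suc d))) _ _ = s≤s (s≤s (s≤s z≤n))
    weight : (i? : Dec (Inner v)) (r? : Dec (v ≡ root)) →
             2 + ⟦ does (¬? i?) ⟧ ≤ deg G v + 2 * ⟦ ⌊ deg G v ℕ.≟ 1 ⌋ ⟧ + 4 * ⟦ does r? ⟧
    weight (yes (_ , dv≡2)) _ = ≤-trans (≤-reflexive (sym dv≡2)) (≤-trans (m≤m+n _ _) (m≤m+n _ _))
    weight (no _)     (yes _)     = ≤-trans (s≤s (s≤s (s≤s z≤n))) (m≤n+m _ _)
    weight (no ¬inner) (no v≢root) =
      ≤-trans (weight-≢2 (deg G v) (adj⇒deg≥1 (parent-adj v≢root)) (λ dv≡2 → ¬inner (v≢root , dv≡2)))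
              (m≤m+n _ _)

  outer-count : length (filter (¬? ∘ inner?) (allFin n)) ≤ 2 * numLeaves G + 4
  outer-count = +-cancelˡ-≤ (2 * n) _ _ (begin
    2 * n + length (filter (¬? ∘ inner?) (allFin n))
      ≡⟨ cong₂ _+_ (trans (*-comm 2 n) (sym (∑-const n 2)))
                   (trans (length-filter≡sum (¬? ∘ inner?) (allFin n)) (sum-map-allFin n outer)) ⟩
    ∑[ v < n ] 2 + ∑[ v < n ] outer v
      ≡⟨ ∑-distrib-+ (λ _ → 2) outer ⟨
    ∑[ v < n ] (2 + outer v)
      ≤⟨ ∑-mono-≤ outer-weight ⟩
    ∑[ v < n ] (deg G v + 2 * leaf v + 4 * δ v root)
      ≡⟨ trans (∑-distrib-+ (λ v → deg G v + 2 * leaf v) (λ v → 4 * δ v root))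
               (cong (_+ ∑[ v < n ] (4 * δ v root)) (∑-distrib-+ (deg G) (λ v → 2 * leaf v))) ⟩
    ∑[ v < n ] deg G v + ∑[ v < n ] (2 * leaf v) + ∑[ v < n ] (4 * δ v root)
      ≡⟨ cong₂ (λ a b → ∑[ v < n ] deg G v + a + b)
               (trans (sym (*-distribˡ-sum 2 leaf)) (cong (2 *_) (sym (sum-map-allFin n leaf))))
               (trans (sym (*-distribˡ-sum 4 (λ v → δ v root))) (cong (4 *_) (∑-δ root))) ⟩
    ∑[ v < n ] deg G v + 2 * numLeaves G + 4
      ≤⟨ +-monoˡ-≤ 4 (+-monoˡ-≤ (2 * numLeaves G) ∑deg≤2n) ⟩
    2 * n + 2 * numLeaves G + 4
      ≡⟨ +-assoc (2 * n) _ 4 ⟩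
    2 * n + (2 * numLeaves G + 4) ∎)
    where
    open ≤-Reasoning
    outer leaf : Fin n → ℕ
    outer v = ⟦ does (¬? (inner? v)) ⟧
    leaf  v = ⟦ ⌊ deg G v ℕ.≟ 1 ⌋ ⟧

  ancestor : ℕ → Fin n → Fin n
  ancestor zero    v = v
  ancestor (suc i) v = parent (ancestor i v)

  module Blocks (m : ℕ) where

    -- blockIndex v counts the inner vertices from the top of v's upward run
    -- down to v, reduced into 1 … m + 1 (0 if v is not inner): its position
    -- in its block. The fuel depth v suffices, as depth drops along parent.
    blockIndexWithin : ℕ → Fin n → ℕ
    blockIndexWithin zero    v = 0
    blockIndexWithin (suc k) v with inner? v
    ... | yes _ = suc (blockIndexWithin k (parent v) % suc m)
    ... | no  _ = 0

    blockIndex : Fin n → ℕ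
    blockIndex v = blockIndexWithin (depth v) v

    blockIndex-inner : ∀ {v} → Inner v → blockIndex v ≡ suc (blockIndex (parent v) % suc m)
    blockIndex-inner {v} iv = trans (cong (λ k → blockIndexWithin k v) (depth-parent (proj₁ iv))) unfold
      where
      unfold : blockIndexWithin (suc (depth (parent v))) v ≡ suc (blockIndex (parent v) % suc m)
      unfold with inner? v
      ... | yes _   = refl
      ... | no ¬iv = ⊥-elim (¬iv iv)

    blockIndex-outer : ∀ {v} → ¬ Inner v → blockIndex v ≡ 0
    blockIndex-outer {v} ¬iv = outer (depth v)
      where
      outer : ∀ k → blockIndexWithin k v ≡ 0
      outer zero = refl
      outer (suc k) with inner? v
      ... | yes iv = ⊥-elim (¬iv iv)
      ... | no  _  = refl

    blockIndex≤ : ∀ v → blockIndex v ≤ suc m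
    blockIndex≤ v with inner? v
    ... | yes iv = subst (_≤ suc m) (sym (blockIndex-inner iv)) (m%n<n (blockIndex (parent v)) (suc m))
    ... | no ¬iv = subst (_≤ suc m) (sym (blockIndex-outer ¬iv)) z≤n

    blockIndex>0⇒inner : ∀ {v} → 0 < blockIndex v → Inner v
    blockIndex>0⇒inner {v} 0<bv with inner? v
    ... | yes iv = iv
    ... | no ¬iv = ⊥-elim (<⇒≢ 0<bv (sym (blockIndex-outer ¬iv)))

    inner⇒blockIndex>0 : ∀ {v} → Inner v → 0 < blockIndex v
    inner⇒blockIndex>0 iv = subst (0 <_) (sym (blockIndex-inner iv)) z<s

    blockIndex-step : ∀ {v} → 1 < blockIndex v → blockIndex v ≡ suc (blockIndex (parent v))
    blockIndex-step {v} 1<bv = step (m≤n⇒m<n∨m≡n (blockIndex≤ (parent v)))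
      where
      open ≡-Reasoning
      unfold : blockIndex v ≡ suc (blockIndex (parent v) % suc m)
      unfold = blockIndex-inner (blockIndex>0⇒inner (<-trans z<s 1<bv))
      step : blockIndex (parent v) < suc m ⊎ blockIndex (parent v) ≡ suc m →
             blockIndex v ≡ suc (blockIndex (parent v))
      step (inj₁ bpv<M) = trans unfold (cong suc (m<n⇒m%n≡m bpv<M))
      step (inj₂ bpv≡M) = ⊥-elim (<⇒≢ 1<bv (sym (begin
        blockIndex v                        ≡⟨ unfold ⟩
        suc (blockIndex (parent v) % suc m) ≡⟨ cong (λ b → suc (b % suc m)) bpv≡M ⟩
        suc (suc m % suc m)                 ≡⟨ cong suc (n%n≡0 (suc m)) ⟩
        1                                   ∎)))

    blockIndex-ancestor : ∀ {i v} → i < blockIndex v → blockIndex (ancestor i v) + i ≡ blockIndex v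
    blockIndex-ancestor {zero}      _    = +-identityʳ _
    blockIndex-ancestor {suc i} {v} i<bv = begin
      blockIndex (parent a) + suc i       ≡⟨ +-suc _ i ⟩
      suc (blockIndex (parent a)) + i     ≡⟨ cong (_+ i) (blockIndex-step 1<ba) ⟨
      blockIndex a + i                    ≡⟨ ih ⟩
      blockIndex v                        ∎
      where
      open ≡-Reasoning
      a  = ancestor i v
      ih = blockIndex-ancestor (<-trans (n<1+n i) i<bv)
      1<ba : 1 < blockIndex a
      1<ba = +-cancelʳ-≤ i 2 _ (subst (suc i <_) (sym ih) i<bv)

    ancestor-inner : ∀ {i v} → i < blockIndex v → Inner (ancestor i v)
    ancestor-inner {i} i<bv =
      blockIndex>0⇒inner (+-cancelʳ-≤ i 1 _ (subst (i <_) (sym (blockIndex-ancestor i<bv)) i<bv))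

    ancestor-injective : ∀ i {v w} → i < blockIndex v → blockIndex v ≡ blockIndex w →
                         ancestor i v ≡ ancestor i w → v ≡ w
    ancestor-injective zero    _    _     eq = eq
    ancestor-injective (suc i) i<bv bv≡bw eq = ancestor-injective i i≤bv bv≡bw
      (inner-child-unique (ancestor-inner i<bv) (proj₁ (ancestor-inner i≤bv))
        (proj₁ (ancestor-inner (subst (i <_) bv≡bw i≤bv))) refl (sym eq))
      where i≤bv = <-trans (n<1+n i) i<bv

    ancestor-level-injective : ∀ {i j v w} → i < blockIndex v → j < blockIndex w →
                               blockIndex v ≡ blockIndex w → ancestor i v ≡ ancestor j w → i ≡ j
    ancestor-level-injective {i} {j} {v} {w} i<bv j<bw bv≡bw eq =
      +-cancelˡ-≡ (blockIndex (ancestor i v)) i j (begin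
      blockIndex (ancestor i v) + i ≡⟨ blockIndex-ancestor i<bv ⟩
      blockIndex v                  ≡⟨ bv≡bw ⟩
      blockIndex w                  ≡⟨ blockIndex-ancestor j<bw ⟨
      blockIndex (ancestor j w) + j ≡⟨ cong (λ x → blockIndex x + j) eq ⟨
      blockIndex (ancestor i v) + j ∎)
      where open ≡-Reasoning

    Bottom : Pred (Fin n) 0ℓ
    Bottom v = blockIndex v ≡ suc m

    bottom? : Decidable Bottom
    bottom? v = blockIndex v ℕ.≟ suc m

    <blockIndex : ∀ {v i} → Bottom v → i < suc m → i < blockIndex v
    <blockIndex bv i<M = subst (_ <_) (sym bv) i<M

    segment : Fin n → List (Fin n)
    segment v = applyUpTo (λ i → ancestor i v) (suc m)

    segment-length : ∀ v → length (segment v) ≡ suc m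
    segment-length v = length-applyUpTo (λ i → ancestor i v) (suc m)

    module _ {v} (bv : Bottom v) where

      segment-linked : Linked (Adj G) (segment v)
      segment-linked = Linkedₚ.applyUpTo⁺₁ (λ i → ancestor i v) (suc m) λ si<M →
        parent-adj (proj₁ (ancestor-inner (<blockIndex bv (<-trans (n<1+n _) si<M))))

      segment-unique : Unique (segment v)
      segment-unique = AllPairsₚ.applyUpTo⁺₁ (λ i → ancestor i v) (suc m) λ i<j j<M eq →
        <⇒≢ i<j (ancestor-level-injective (<blockIndex bv (<-trans i<j j<M)) (<blockIndex bv j<M) refl eq)

      segment-inner : All Inner (segment v)
      segment-inner = Allₚ.applyUpTo⁺₁ (λ i → ancestor i v) (suc m) (ancestor-inner ∘ <blockIndex bv)

      segment-bare : IsBarePath G (segment v) × pathLength G (segment v) ≡ m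
      segment-bare = ((segment-linked , segment-unique) , All-interior (All.map proj₂ segment-inner)) ,
                     cong (_∸ 1) (segment-length v)

    segments-disjoint : ∀ {v w} → Bottom v → Bottom w → v ≢ w → Disjoint (segment v) (segment w)
    segments-disjoint {v} {w} bv bw v≢w (x∈v , x∈w)
      with ∈-applyUpTo⁻ (λ i → ancestor i v) x∈v | ∈-applyUpTo⁻ (λ j → ancestor j w) x∈w
    ... | i , i<M , refl | j , j<M , eq
      with ancestor-level-injective (<blockIndex bv i<M) (<blockIndex bw j<M) (trans bv (sym bw)) eq
    ... | refl = v≢w (ancestor-injective i (<blockIndex bv i<M) (trans bv (sym bw)) eq)

    -- Where a walk of t steps down from x ends; inner vertices have exactly one child.
    Descent : ℕ → Fin n → Set
    Descent t x = (∃ λ y → blockIndex y ≡ blockIndex x + t × ancestor t y ≡ x) ⊎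
                  (∃₂ λ c i → ¬ Inner c × i ≤ t × ancestor i c ≡ x)

    descend : ∀ t {x} → Inner x → blockIndex x + t ≤ suc m → Descent t x
    descend zero    {x} _  _    = inj₁ (x , sym (+-identityʳ _) , refl)
    descend (suc t) {x} ix bx+t≤ with inner-child ix
    ... | y , py≡x with inner? y
    ...   | no ¬iy = inj₂ (y , 1 , ¬iy , s≤s z≤n , py≡x)
    ...   | yes iy = extend (descend t iy (≤-trans (≤-reflexive by+t) bx+t≤))
      where
      bx<M : blockIndex x < suc m
      bx<M = ≤-trans (s≤s (m≤m+n _ t)) (subst (_≤ suc m) (+-suc _ t) bx+t≤)
      by : blockIndex y ≡ suc (blockIndex x)
      by = begin
        blockIndex y                        ≡⟨ blockIndex-inner iy ⟩
        suc (blockIndex (parent y) % suc m) ≡⟨ cong (λ p → suc (blockIndex p % suc m)) py≡x ⟩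
        suc (blockIndex x % suc m)          ≡⟨ cong suc (m<n⇒m%n≡m bx<M) ⟩
        suc (blockIndex x)                  ∎
        where open ≡-Reasoning
      by+t : blockIndex y + t ≡ blockIndex x + suc t
      by+t = trans (cong (_+ t) by) (sym (+-suc _ t))
      extend : Descent t y → Descent (suc t) x
      extend (inj₁ (z , bz , az≡y))           = inj₁ (z , trans bz by+t , trans (cong parent az≡y) py≡x)
      extend (inj₂ (c , i , ¬ic , i≤t , ac≡y)) =
        inj₂ (c , suc i , ¬ic , s≤s i≤t , trans (cong parent ac≡y) py≡x)

    ends : Fin n → List (Fin n)
    ends y = y ∷ ancestor m y ∷ []

    bottoms outers : List (Fin n)
    bottoms = filter bottom? (allFin n)
    outers  = filter (¬? ∘ inner?) (allFin n)

    segments : List (List (Fin n))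
    segments = map segment bottoms

    segments-bare : All (λ P → IsBarePath G P × pathLength G P ≡ m) segments
    segments-bare = Allₚ.map⁺ (All.map segment-bare (Allₚ.all-filter bottom? (allFin n)))

    segments-pairwise-disjoint : AllPairs Disjoint segments
    segments-pairwise-disjoint = AllPairsₚ.map⁺
      (AllPairs-map-All segments-disjoint (Allₚ.all-filter bottom? (allFin n)) (filter⁺ bottom? (allFin⁺ n)))

    segments-size : length bottoms * suc m ≤ n
    segments-size = begin
      length bottoms * suc m             ≡⟨ length-concatMap segment segment-length bottoms ⟨
      length (concatMap segment bottoms) ≤⟨ Unique-⊆⇒length≤ segments-unique (λ {x} _ → ∈-allFin x) ⟩
      length (allFin n)                  ≡⟨ length-tabulate id ⟩
      n                                  ∎
      where
      open ≤-Reasoning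
      segments-unique : Unique (concatMap segment bottoms)
      segments-unique = concat⁺ (Allₚ.map⁺ (All.map segment-unique (Allₚ.all-filter bottom? (allFin n))))
                                segments-pairwise-disjoint

    ∈-ends : ∀ {x y} → Bottom y → x ∈ ends y → x ∈ concatMap ends bottoms
    ∈-ends {y = y} by x∈ = ∈-concat⁺′ x∈ (∈-map⁺ ends (∈-filter⁺ bottom? (∈-allFin y) by))

    ∈-segment-outer : ∀ {c i} → ¬ Inner c → i ≤ m → ancestor i c ∈ concatMap segment outers
    ∈-segment-outer {c} ¬ic i≤m = ∈-concat⁺′ (∈-applyUpTo⁺ (λ i → ancestor i c) (s≤s i≤m))
                                             (∈-map⁺ segment (∈-filter⁺ (¬? ∘ inner?) (∈-allFin c) ¬ic))

    bottom-ancestor-∉interiors : ∀ {y t} → Bottom y → t ≤ m →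
                                 ancestor t y ∉ concatMap interior segments → ancestor t y ∈ concatMap ends bottoms
    bottom-ancestor-∉interiors {y} {t} by t≤m ∉interiors with t ℕ.≟ 0 | t ℕ.≟ m
    ... | yes refl | _        = ∈-ends by (here refl)
    ... | no _     | yes refl = ∈-ends by (there (here refl))
    ... | no t≢0   | no t≢m   = ⊥-elim (∉interiors (∈-concat⁺′
      (∈-interior-applyUpTo (λ i → ancestor i y) (n≢0⇒n>0 t≢0) (≤∧≢⇒< t≤m t≢m))
      (∈-map⁺ interior (∈-map⁺ segment (∈-filter⁺ bottom? (∈-allFin y) by)))))

    ∉interiors⇒∈cover : ∀ {u} → u ∉ concatMap interior segments →
                        u ∈ concatMap segment outers ++ concatMap ends bottoms
    ∉interiors⇒∈cover {u} u∉ with inner? u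
    ... | no ¬iu = ∈-++⁺ˡ (∈-segment-outer ¬iu z≤n)
    ... | yes iu with descend (suc m ∸ blockIndex u) iu (≤-reflexive (m+[n∸m]≡n (blockIndex≤ u)))
    ...   | inj₁ (y , by , aty≡u) = ∈-++⁺ʳ (concatMap segment outers) (subst (_∈ _) aty≡u
      (bottom-ancestor-∉interiors (trans by (m+[n∸m]≡n (blockIndex≤ u)))
        (∸-monoʳ-≤ (suc m) (inner⇒blockIndex>0 iu)) (subst (_∉ _) (sym aty≡u) u∉)))
    ...   | inj₂ (c , i , ¬ic , i≤t , aic≡u) = ∈-++⁺ˡ (subst (_∈ _) aic≡u
      (∈-segment-outer ¬ic (≤-trans i≤t (∸-monoʳ-≤ (suc m) (inner⇒blockIndex>0 iu)))))

    remaining≤ : remainingSize G segments ≤ length outers * suc m + length bottoms * 2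
    remaining≤ = begin
      remainingSize G segments
        ≤⟨ Unique-⊆⇒length≤ (filter⁺ _ (allFin⁺ n))
             (λ u∈ → ∉interiors⇒∈cover (proj₂ (∈-filter⁻ _ {xs = allFin n} u∈))) ⟩
      length (concatMap segment outers ++ concatMap ends bottoms)
        ≡⟨ length-++ (concatMap segment outers) ⟩
      length (concatMap segment outers) + length (concatMap ends bottoms)
        ≡⟨ cong₂ _+_ (length-concatMap segment segment-length outers)
                     (length-concatMap ends (λ _ → refl) bottoms) ⟩
      length outers * suc m + length bottoms * 2 ∎
      where open ≤-Reasoning

packing-arithmetic : ∀ {m ℓ n R N C} → 2 ≤ m → 2 ≤ ℓ →
                     R ≤ N * suc m + C * 2 → C * suc m ≤ n → N ≤ 2 * ℓ + 4 →
                     (m + 1) * R ≤ 6 * m * ℓ * (m + 1) + 2 * n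
packing-arithmetic {m@(suc (suc a))} {ℓ@(suc (suc b))} {n} {R} {N} {C}
                   (s≤s (s≤s z≤n)) (s≤s (s≤s z≤n)) R≤ C≤ N≤ = begin
  (m + 1) * R
    ≤⟨ *-monoʳ-≤ (m + 1) R≤ ⟩
  (m + 1) * (N * suc m + C * 2)
    ≡⟨ regroup ⟩
  (m + 1) * ((m + 1) * N) + 2 * (C * suc m)
    ≤⟨ +-mono-≤ (*-monoʳ-≤ (m + 1) (*-monoʳ-≤ (m + 1) N≤)) (*-monoʳ-≤ 2 C≤) ⟩
  (m + 1) * ((m + 1) * (2 * ℓ + 4)) + 2 * n
    ≤⟨ +-monoˡ-≤ (2 * n) (*-monoʳ-≤ (m + 1) (m≤m+n ((m + 1) * (2 * ℓ + 4)) excess)) ⟩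
  (m + 1) * ((m + 1) * (2 * ℓ + 4) + excess) + 2 * n
    ≡⟨ cong (λ k → (m + 1) * k + 2 * n) slack ⟩
  (m + 1) * (6 * m * ℓ) + 2 * n
    ≡⟨ cong (_+ 2 * n) (*-comm (m + 1) (6 * m * ℓ)) ⟩
  6 * m * ℓ * (m + 1) + 2 * n ∎
  where
  open ≤-Reasoning
  open +-*-Solver
  excess : ℕ
  excess = 4 * a + 6 * b + 4 * a * b
  regroup : (m + 1) * (N * suc m + C * 2) ≡ (m + 1) * ((m + 1) * N) + 2 * (C * suc m)
  regroup = solve 3 (λ m N C → (m :+ con 1) :* (N :* (con 1 :+ m) :+ C :* con 2)
                           := (m :+ con 1) :* ((m :+ con 1) :* N) :+ con 2 :* (C :* (con 1 :+ m))) refl m N C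
  slack : (m + 1) * (2 * ℓ + 4) + excess ≡ 6 * m * ℓ
  slack = solve 2 (λ a b → (con 2 :+ a :+ con 1) :* (con 2 :* (con 2 :+ b) :+ con 4)
                           :+ (con 4 :* a :+ con 6 :* b :+ con 4 :* a :* b)
                         := con 6 :* (con 2 :+ a) :* (con 2 :+ b)) refl a b

lemma4p1 : (ℓ m : ℕ) → 2 ≤ ℓ → 2 ≤ m →
    (n : ℕ) (G : Graph n) → IsTree G → numLeaves G ≤ ℓ →
    ∃ λ (Ps : List (List (Fin n))) →
      All (λ P → IsBarePath G P × pathLength G P ≡ m) Ps ×
      AllPairs Disjoint Ps ×
      (m + 1) * remainingSize G Ps ≤ 6 * m * ℓ * (m + 1) + 2 * n
lemma4p1 ℓ m _   _   zero    G _ _ = [] , [] , [] , ≤-trans (≤-reflexive (*-zeroʳ (m + 1))) z≤n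
lemma4p1 ℓ m 2≤ℓ 2≤m (suc n) G (symmetric , loopless , connected , acyclic) leaves≤ℓ =
  segments , segments-bare , segments-pairwise-disjoint ,
  packing-arithmetic {N = length outers} {C = length bottoms} 2≤m 2≤ℓ remaining≤ segments-size outers≤
  where
  open RootedTree G symmetric loopless connected acyclic zero
  open Blocks m
  outers≤ : length outers ≤ 2 * ℓ + 4
  outers≤ = ≤-trans outer-count (+-monoˡ-≤ 4 (*-monoʳ-≤ 2 leaves≤ℓ))
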